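{- Let $k$ be an integer with a representation with respect to the sequence $F_2,F_3,F_4,\ldots=2,3,5,\ldots$ that satisfies Property 1 and Property 2, and suppose the largest Fibonacci number appearing in this representation is $F_t$. Then $k\le F_{t+1}+1$.
   Context: $(F_n)_{n\ge0}$ is the Fibonacci sequence with $F_0=F_1=1$, $F_{n+1}=F_n+F_{n-1}$. A representation of a positive integer $k$ with respect to $F_2,F_3,\ldots$ is a finite multiset of terms $F_j$ ($j\ge2$) summing to $k$. A representation has Property 1 if it does not contain two consecutive Fibonacci numbers $F_j$ and $F_{j+1}$. It has Property 2 if no $F_j$ appears twice or more, except that $F_2=2$ or $F_3=3$ may appear twice, but not both simultaneously. -}

module Defs where

open import Data.Nat using (ℕ; zero; suc; _+_; _≤_; _<_)
open import Data.List using (List; map; filter; length)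
open import Data.Nat.ListAction using (sum)
open import Data.List.Membership.Propositional using (_∈_)
open import Data.List.Relation.Unary.All using (All)
open import Data.Nat.Properties using (_≟_)
open import Relation.Binary.PropositionalEquality using (_≡_)
open import Relation.Nullary using (¬_)
open import Data.Product using (_×_)

F : ℕ → ℕ
F zero = 1
F (suc zero) = 1
F (suc (suc n)) = F (suc n) + F n

-- A representation is a finite multiset of indices j (each ≥ 2),
-- encoded as a list of indices; it represents the sum of the F j.
IndicesValid : List ℕ → Set
IndicesValid js = All (λ j → 2 ≤ j) js

value : List ℕ → ℕ
value js = sum (map F js)

mult : ℕ → List ℕ → ℕ
mult j js = length (filter (λ i → i ≟ j) js)

Property1 : List ℕ → Set
Property1 js = ∀ j → j ∈ js → ¬ (suc j ∈ js)

Property2 : List ℕ → Set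
Property2 js =
  (∀ j → 4 ≤ j → mult j js ≤ 1)
  × mult 2 js ≤ 2
  × mult 3 js ≤ 2
  × ¬ (2 ≤ mult 2 js × 2 ≤ mult 3 js)

-- Strip all copies of the largest index t and induct on t.  If F t does not
-- occur, the bound for t − 1 already gives F t + 1 ≤ F (t + 1) + 1.  If it
-- does, Property 1 excludes F (t − 1), so the rest uses indices ≤ t − 2 and
-- is at most F (t − 1) + 1 by induction.  For t ≥ 4, F t occurs once and
-- F t + F (t − 1) + 1 = F (t + 1) + 1; for t = 2, 3 the rest is empty and
-- F t occurs at most twice, with 2 F t ≤ F (t + 1) + 1.
module Submission where

open import Defs
open import Data.Nat using (ℕ; zero; suc; _+_; _*_; _≤_; _<_; z≤n; s≤s)
open import Data.Nat.Properties
open import Data.List using (List; []; _∷_; filter; length)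
open import Data.List.Properties using (filter-accept; filter-reject)
open import Data.List.Membership.Propositional using (_∈_)
open import Data.List.Membership.Propositional.Properties using (∈-filter⁻)
open import Data.List.Relation.Binary.Sublist.Propositional.Properties
  using (filter-⊆; length-mono-≤)
  renaming (filter⁺ to filter-⊆-mono)
open import Data.List.Relation.Unary.All as All using (All; []; _∷_)
open import Data.List.Relation.Unary.All.Properties using (filter⁺)
open import Data.List.Relation.Unary.Any using (here; there)
open import Data.Product using (_×_; _,_; proj₁; proj₂)
open import Relation.Binary.PropositionalEquality
open import Relation.Nullary using (¬_; yes; no; ¬?)
open import Relation.Unary using (Decidable)

without : ℕ → List ℕ → List ℕ
without t = filter (λ i → ¬? (i ≟ t))

∈-without⁻ : ∀ {x} t js → x ∈ without t js → x ∈ js × x ≢ t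
∈-without⁻ t js = ∈-filter⁻ (λ i → ¬? (i ≟ t))

mult-filter-≤ : ∀ {p} {P : ℕ → Set p} (P? : Decidable P) j js → mult j (filter P? js) ≤ mult j js
mult-filter-≤ P? j js =
  length-mono-≤ (filter-⊆-mono (_≟ j) (_≟ j) (λ { refl i≡j → i≡j }) (filter-⊆ P? js))

mult-∷-≡ : ∀ x xs → mult x (x ∷ xs) ≡ suc (mult x xs)
mult-∷-≡ x xs = cong length (filter-accept (_≟ x) refl)

mult-∷-≢ : ∀ {x j} xs → x ≢ j → mult j (x ∷ xs) ≡ mult j xs
mult-∷-≢ xs x≢j = cong length (filter-reject (_≟ _) x≢j)

mult-pos⇒∈ : ∀ j js → 0 < mult j js → j ∈ js
mult-pos⇒∈ j (x ∷ xs) pos with x ≟ j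
... | yes refl = here refl
... | no x≢j = there (mult-pos⇒∈ j xs (subst (0 <_) (mult-∷-≢ xs x≢j) pos))

value-without : ∀ t js → value js ≡ mult t js * F t + value (without t js)
value-without t [] = refl
value-without t (x ∷ xs) with x ≟ t
... | yes refl = begin
  F x + value xs                                   ≡⟨ cong (F x +_) (value-without x xs) ⟩
  F x + (mult x xs * F x + value (without x xs))   ≡⟨ +-assoc (F x) _ _ ⟨
  suc (mult x xs) * F x + value (without x xs)     ≡⟨ cong₂ (λ m r → m * F x + value r)
                                                        (mult-∷-≡ x xs)
                                                        (filter-reject (λ i → ¬? (i ≟ x)) (λ x≢x → x≢x refl)) ⟨
  mult x (x ∷ xs) * F x + value (without x (x ∷ xs)) ∎
  where open ≡-Reasoning
... | no x≢t = begin
  F x + value xs                                   ≡⟨ cong (F x +_) (value-without t xs) ⟩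
  F x + (mult t xs * F t + value (without t xs))   ≡⟨ +-assoc (F x) _ _ ⟨
  (F x + mult t xs * F t) + value (without t xs)   ≡⟨ cong (_+ value (without t xs)) (+-comm (F x) _) ⟩
  (mult t xs * F t + F x) + value (without t xs)   ≡⟨ +-assoc (mult t xs * F t) _ _ ⟩
  mult t xs * F t + value (x ∷ without t xs)       ≡⟨ cong₂ (λ m r → m * F t + value r)
                                                        (mult-∷-≢ xs x≢t)
                                                        (filter-accept (λ i → ¬? (i ≟ t)) x≢t) ⟨
  mult t (x ∷ xs) * F t + value (without t (x ∷ xs)) ∎
  where open ≡-Reasoning

maxMult : ℕ → ℕ
maxMult (suc (suc (suc (suc _)))) = 1
maxMult _ = 2

record Admissible (js : List ℕ) : Set where
  field
    valid       : IndicesValid js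
    property1   : Property1 js
    repetitions : ∀ j → 2 ≤ j → mult j js ≤ maxMult j

open Admissible

admissible-without : ∀ t {js} → Admissible js → Admissible (without t js)
admissible-without t {js} adm = record
  { valid       = All.tabulate λ m → All.lookup (valid adm) (proj₁ (∈-without⁻ t js m))
  ; property1   = λ j m m′ → property1 adm j (proj₁ (∈-without⁻ t js m)) (proj₁ (∈-without⁻ t js m′))
  ; repetitions = λ j 2≤j → ≤-trans (mult-filter-≤ _ j js) (repetitions adm j 2≤j)
  }

property2⇒admissible : ∀ {js} → IndicesValid js → Property1 js → Property2 js → Admissible js
property2⇒admissible {js} v p1 (m≥4 , m2 , m3 , _) = record
  { valid = v ; property1 = p1 ; repetitions = repetitions′ }
  where
  repetitions′ : ∀ j → 2 ≤ j → mult j js ≤ maxMult j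
  repetitions′ 0 ()
  repetitions′ 1 (s≤s ())
  repetitions′ 2 _ = m2
  repetitions′ 3 _ = m3
  repetitions′ j@(suc (suc (suc (suc _)))) _ = m≥4 j (s≤s (s≤s (s≤s (s≤s z≤n))))

indices≤1⇒[] : ∀ {js} → IndicesValid js → All (_≤ 1) js → js ≡ []
indices≤1⇒[] [] [] = refl
indices≤1⇒[] (s≤s (s≤s _) ∷ _) (s≤s () ∷ _)

below-absent : ∀ {u js} → All (_≤ suc u) js → ¬ suc u ∈ js → All (_≤ u) js
below-absent ≤1+u 1+u∉js = All.tabulate λ j∈js →
  ≤-pred (≤∧≢⇒< (All.lookup ≤1+u j∈js) λ { refl → 1+u∉js j∈js })

without-below : ∀ u {js} → All (_≤ suc u) js → All (_≤ u) (without (suc u) js)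
without-below u {js} ≤1+u =
  below-absent (filter⁺ _ ≤1+u) (λ m → proj₂ (∈-without⁻ (suc u) js m) refl)

top-copies-bound : ∀ u {m} rest → IndicesValid rest → All (_≤ u) rest →
  value rest ≤ F (suc u) + 1 → m ≤ maxMult (2 + u) →
  m * F (2 + u) + value rest ≤ F (3 + u) + 1
top-copies-bound 0 rest v ≤0 _ m≤2 with refl ← indices≤1⇒[] v (All.map m≤n⇒m≤1+n ≤0) =
  +-monoˡ-≤ 0 (*-monoˡ-≤ (F 2) m≤2)
top-copies-bound 1 rest v ≤1 _ m≤2 with refl ← indices≤1⇒[] v ≤1 =
  +-monoˡ-≤ 0 (*-monoˡ-≤ (F 3) m≤2)
top-copies-bound u@(suc (suc _)) {m} rest _ _ rest-bound m≤1 = begin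
  m * F T + value rest       ≤⟨ +-monoˡ-≤ (value rest) (*-monoˡ-≤ (F T) m≤1) ⟩
  1 * F T + value rest       ≡⟨ cong (_+ value rest) (*-identityˡ (F T)) ⟩
  F T + value rest           ≤⟨ +-monoʳ-≤ (F T) rest-bound ⟩
  F T + (F (suc u) + 1)      ≡⟨ +-assoc (F T) _ 1 ⟨
  F (suc T) + 1              ∎
  where
  open ≤-Reasoning
  T = 2 + u

ValueBound : ℕ → Set
ValueBound t = ∀ js → Admissible js → All (_≤ t) js → value js ≤ F (suc t) + 1

value-bound-step : ∀ u → ValueBound (suc u) → ValueBound u → ValueBound (2 + u)
value-bound-step u bound₁ bound₀ js adm ≤t = begin
  value js                     ≡⟨ value-without t js ⟩
  mult t js * F t + value rest ≤⟨ by-copies (mult t js) refl ⟩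
  F (suc t) + 1                ∎
  where
  open ≤-Reasoning
  t = 2 + u
  rest = without t js
  adm′ = admissible-without t adm
  by-copies : ∀ m → mult t js ≡ m → m * F t + value rest ≤ F (suc t) + 1
  by-copies zero _ = begin
    value rest      ≤⟨ bound₁ rest adm′ (without-below (suc u) ≤t) ⟩
    F t + 1         ≤⟨ +-monoˡ-≤ 1 (m≤m+n (F t) _) ⟩
    F (suc t) + 1   ∎
  by-copies (suc _) mult≡m =
    top-copies-bound u rest (valid adm′) rest≤u (bound₀ rest adm′ rest≤u)
      (subst (_≤ maxMult t) mult≡m (repetitions adm t (s≤s (s≤s z≤n))))
    where
    t∈js : t ∈ js
    t∈js = mult-pos⇒∈ t js (subst (0 <_) (sym mult≡m) (s≤s z≤n))
    rest≤u : All (_≤ u) rest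
    rest≤u = below-absent (without-below (suc u) ≤t)
      (λ 1+u∈rest → property1 adm (suc u) (proj₁ (∈-without⁻ t js 1+u∈rest)) t∈js)

value-bound : ∀ t → ValueBound t
value-bound 0 js adm ≤0 with refl ← indices≤1⇒[] (valid adm) (All.map m≤n⇒m≤1+n ≤0) = z≤n
value-bound 1 js adm ≤1 with refl ← indices≤1⇒[] (valid adm) ≤1 = z≤n
value-bound (suc (suc u)) = value-bound-step u (value-bound (suc u)) (value-bound u)

lemma7 : (k t : ℕ) (js : List ℕ) →
    IndicesValid js → value js ≡ k →
    Property1 js → Property2 js →
    t ∈ js → All (λ j → j ≤ t) js →
    k ≤ F (t + 1) + 1
lemma7 k t js v refl p1 p2 _ ≤t rewrite +-comm t 1 =
  value-bound t js (property2⇒admissible v p1 p2) ≤t
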